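{- Each equation $(\Delta_{\alpha},\nabla_{\!\beta})^{*}$ corresponds to the frame condition $(\Delta_{\alpha},\nabla_{\!\beta})^{*}$, i.e. a modal frame (containing the relevant modalities) satisfies the frame condition $(\Delta_{\alpha},\nabla_{\!\beta})^{*}$ if and only if its complex algebra satisfies the equation $(\Delta_{\alpha},\nabla_{\!\beta})^{*}$.
   Context: A frame is a poset $(W,\le)$ with relations $R^{\Box}_+,R^{\Box}_-,R^{\Diamond}_+,R^{\Diamond}_-$ (those for modalities in the signature $\mathcal{L}$), where a $\Box_\alpha$-relation is an upset of $(W,\ge)\times(W,\le)^\alpha$ and a $\Diamond_\alpha$-relation an upset of $(W,\le)\times(W,\le)^{ -\alpha}$ ($(W,\le)^+=(W,\le)$, $(W,\le)^-=(W,\ge)$); in this setting the frame is assumed unimodal, i.e. each $R^\Delta_\alpha$ is generated by a single relation $R=\bigcap R^\Delta_\alpha$ via $R^\Box_+={\le}\circ R\circ{\le}$, $R^\Diamond_+={\ge}\circ R\circ{\ge}$, $R^\Box_-={\le}\circ R\circ{\ge}$, $R^\Diamond_-={\ge}\circ R\circ{\le}$. The complex algebra is the lattice of upsets (a bi-Heyting algebra) with $\Box_+a=\{u: uR^\Box_+v\Rightarrow v\in a\}$, $\Box_-a=\{u: uR^\Box_-v\Rightarrow v\notin a\}$, $\Diamond_+a=\{u:\exists v\in a,\ uR^\Diamond_+v\}$, $\Diamond_-a=\{u:\exists v\notin a,\ uR^\Diamond_-v\}$. $\rightarrow$ is Heyting implication and $-$ co-implication. Equations and frame conditions (backward modalities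 written $\overleftarrow{\Box}_\alpha,\overleftarrow{\Diamond}_\alpha$; they serve only as labels): $(\Diamond_+,\Box_+)^*$: $\Box_+a\wedge\Diamond_+b\le\Diamond_+(a\wedge b)$ / $R^\Diamond_+\subseteq(R^\Diamond_+\cap R^\Box_+)\circ{\ge}$; $(\Diamond_-,\Box_-)^*$: $\Box_-a\wedge\Diamond_-b\le\Diamond_-(a\vee b)$ / $R^\Diamond_-\subseteq(R^\Diamond_-\cap R^\Box_-)\circ{\le}$; $(\Box_+,\Diamond_+)^*$: $\Box_+(a\vee b)\le\Box_+a\vee\Diamond_+b$ / $R^\Box_+\subseteq(R^\Box_+\cap R^\Diamond_+)\circ{\le}$; $(\Box_-,\Diamond_-)^*$: $\Box_-(a\wedge b)\le\Box_-a\vee\Diamond_-b$ / $R^\Box_-\subseteq(R^\Box_-\cap R^\Diamond_-)\circ{\ge}$; $(\Diamond_+,\Box_-)^*$: $\Box_-a\wedge\Diamond_+a\le\bot$ / $R^\Diamond_+\subseteq R^\Box_-$; $(\Diamond_-,\Box_+)^*$: $\Box_+a\wedge\Diamond_-a\le\bot$ / $R^\Diamond_-\subseteq R^\Box_+$; $(\Box_+,\Diamond_-)^*$: $\top\le\Box_+a\vee\Diamond_-a$ / $R^\Box_+\subseteq R^\Diamond_-$; $(\Box_-,\Diamond_+)^*$: $\top\le\Box_-a\vee\Diamond_+a$ / $R^\Box_-\subseteq R^\Diamond_+$; $(\overleftarrow{\Diamond}_+,\overleftarrow{\Box}_+)^*$: $\Diamond_+a\rightarrow\Box_+b\le\Box_+(a\rightarrow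 b)$ / $R^\Box_+\subseteq{\le}\circ(R^\Box_+\cap R^\Diamond_+)$; $(\overleftarrow{\Diamond}_-,\overleftarrow{\Box}_-)^*$: $\Diamond_-(a\rightarrow b)\le\Diamond_-b-\Box_-a$ / $R^\Diamond_-\subseteq{\ge}\circ(R^\Diamond_-\cap R^\Box_-)$; $(\overleftarrow{\Box}_+,\overleftarrow{\Diamond}_+)^*$: $\Diamond_+(b-a)\le\Diamond_+b-\Box_+a$ / $R^\Diamond_+\subseteq{\ge}\circ(R^\Diamond_+\cap R^\Box_+)$; $(\overleftarrow{\Box}_-,\overleftarrow{\Diamond}_-)^*$: $\Diamond_-a\rightarrow\Box_-b\le\Box_-(b-a)$ / $R^\Box_-\subseteq{\le}\circ(R^\Box_-\cap R^\Diamond_-)$; $(\overleftarrow{\Diamond}_+,\overleftarrow{\Box}_-)^*$: $\Box_-a\le\Box_+(a\rightarrow\bot)$ / $R^\Box_+\subseteq R^\Box_-$; $(\overleftarrow{\Diamond}_-,\overleftarrow{\Box}_+)^*$: $\Diamond_-(a\rightarrow\bot)\le\Diamond_+a$ / $R^\Diamond_-\subseteq R^\Diamond_+$; $(\overleftarrow{\Box}_+,\overleftarrow{\Diamond}_-)^*$: $\Diamond_+(\top-a)\le\Diamond_-a$ / $R^\Diamond_+\subseteq R^\Diamond_-$; $(\overleftarrow{\Box}_-,\overleftarrow{\Diamond}_+)^*$: $\Box_+a\le\Box_-(\top-a)$ / $R^\Box_-\subseteq R^\Box_+$. -}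

module Defs where

open import Level using (0ℓ)
open import Relation.Binary.Bundles using (Poset)
open import Data.Product using (Σ; ∃; _×_; _,_)
open import Data.Sum using (_⊎_)
open import Data.Empty using (⊥)
open import Data.Unit using (⊤)
open import Relation.Nullary using (¬_)

-- A unimodal frame: a poset (W,≤) with one relation R generating
-- the four relations R^□_+, R^◇_+, R^□_-, R^◇_-.
record Frame : Set₁ where
  field
    poset : Poset 0ℓ 0ℓ 0ℓ
  open Poset poset public using (Carrier; _≤_)
  field
    R : Carrier → Carrier → Set

-- the sixteen equations / frame conditions (Δ_α,∇_β)^*;
-- a 'b' prefix marks the backward-modality labels
data Label : Set where
  DpBp DmBm BpDp BmDm DpBm DmBp BpDm BmDp : Label
  bDpBp bDmBm bBpDp bBmDm bDpBm bDmBp bBpDm bBmDp : Label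

module FrameOps (F : Frame) where
  open Frame F

  W : Set
  W = Carrier

  Rel : Set₁
  Rel = W → W → Set

  _≥_ : Rel
  x ≥ y = y ≤ x

  _⨾_ : Rel → Rel → Rel
  (S ⨾ T) x y = ∃ λ z → S x z × T z y

  _∩_ : Rel → Rel → Rel
  (S ∩ T) x y = S x y × T x y

  _⊆_ : Rel → Rel → Set
  S ⊆ T = ∀ x y → S x y → T x y

  R□+ R◇+ R□- R◇- : Rel
  R□+ = _≤_ ⨾ (R ⨾ _≤_)
  R◇+ = _≥_ ⨾ (R ⨾ _≥_)
  R□- = _≤_ ⨾ (R ⨾ _≥_)
  R◇- = _≥_ ⨾ (R ⨾ _≤_)

  Pred : Set₁
  Pred = W → Set

  record Upset : Set₁ where
    field
      set : Pred
      up  : ∀ x y → x ≤ y → set x → set y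
  open Upset public

  _⊑_ : Pred → Pred → Set
  p ⊑ q = ∀ u → p u → q u

  _∧_ _∨_ _⇒_ _−_ : Pred → Pred → Pred
  (p ∧ q) u = p u × q u
  (p ∨ q) u = p u ⊎ q u
  (p ⇒ q) u = ∀ v → u ≤ v → p v → q v
  (q − p) u = ∃ λ v → v ≤ u × q v × ¬ p v

  ⊤ₚ ⊥ₚ : Pred
  ⊤ₚ _ = ⊤
  ⊥ₚ _ = ⊥

  □+ □- ◇+ ◇- : Pred → Pred
  □+ p u = ∀ v → R□+ u v → p v
  □- p u = ∀ v → R□- u v → ¬ p v
  ◇+ p u = ∃ λ v → p v × R◇+ u v
  ◇- p u = ∃ λ v → ¬ p v × R◇- u v

  condition : Label → Set
  condition DpBp  = R◇+ ⊆ ((R◇+ ∩ R□+) ⨾ _≥_)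
  condition DmBm  = R◇- ⊆ ((R◇- ∩ R□-) ⨾ _≤_)
  condition BpDp  = R□+ ⊆ ((R□+ ∩ R◇+) ⨾ _≤_)
  condition BmDm  = R□- ⊆ ((R□- ∩ R◇-) ⨾ _≥_)
  condition DpBm  = R◇+ ⊆ R□-
  condition DmBp  = R◇- ⊆ R□+
  condition BpDm  = R□+ ⊆ R◇-
  condition BmDp  = R□- ⊆ R◇+
  condition bDpBp = R□+ ⊆ (_≤_ ⨾ (R□+ ∩ R◇+))
  condition bDmBm = R◇- ⊆ (_≥_ ⨾ (R◇- ∩ R□-))
  condition bBpDp = R◇+ ⊆ (_≥_ ⨾ (R◇+ ∩ R□+))
  condition bBmDm = R□- ⊆ (_≤_ ⨾ (R□- ∩ R◇-))
  condition bDpBm = R□+ ⊆ R□-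
  condition bDmBp = R◇- ⊆ R◇+
  condition bBpDm = R◇+ ⊆ R◇-
  condition bBmDp = R□- ⊆ R□+

  inequation : Label → Pred → Pred → Set
  inequation DpBp  a b = (□+ a ∧ ◇+ b) ⊑ ◇+ (a ∧ b)
  inequation DmBm  a b = (□- a ∧ ◇- b) ⊑ ◇- (a ∨ b)
  inequation BpDp  a b = □+ (a ∨ b) ⊑ (□+ a ∨ ◇+ b)
  inequation BmDm  a b = □- (a ∧ b) ⊑ (□- a ∨ ◇- b)
  inequation DpBm  a b = (□- a ∧ ◇+ a) ⊑ ⊥ₚ
  inequation DmBp  a b = (□+ a ∧ ◇- a) ⊑ ⊥ₚ
  inequation BpDm  a b = ⊤ₚ ⊑ (□+ a ∨ ◇- a)
  inequation BmDp  a b = ⊤ₚ ⊑ (□- a ∨ ◇+ a)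
  inequation bDpBp a b = (◇+ a ⇒ □+ b) ⊑ □+ (a ⇒ b)
  inequation bDmBm a b = ◇- (a ⇒ b) ⊑ (◇- b − □- a)
  inequation bBpDp a b = ◇+ (b − a) ⊑ (◇+ b − □+ a)
  inequation bBmDm a b = (◇- a ⇒ □- b) ⊑ □- (b − a)
  inequation bDpBm a b = □- a ⊑ □+ (a ⇒ ⊥ₚ)
  inequation bDmBp a b = ◇- (a ⇒ ⊥ₚ) ⊑ ◇+ a
  inequation bBpDm a b = ◇+ (⊤ₚ − a) ⊑ ◇- a
  inequation bBmDp a b = □+ a ⊑ □- (⊤ₚ − a)

  -- the complex algebra (algebra of upsets) validates the equation
  validates : Label → Set₁
  validates e = (a b : Upset) → inequation e (set a) (set b)

FrameCondition : Label → Frame → Set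
FrameCondition e F = FrameOps.condition F e

ComplexAlgebraSatisfies : Label → Frame → Set₁
ComplexAlgebraSatisfies e F = FrameOps.validates F e

module Submission where

-- That each condition validates its equation is a direct element chase through the
-- definitions of the four modalities.  Conversely, to extract a frame condition at a
-- pair u R v one instantiates the equation with the upsets generated by v (the
-- principal upset ↑v and the complement of the principal downset ↓v) and with the
-- upsets carved out by u (the image R□+[u], R◇-[u] and the complements of R□-[u],
-- R◇+[u]); the conclusion of the equation at u then produces exactly the required
-- intermediate point.  Complements and the negations in □- and ◇- make the argument
-- classical.

open import Defs
open import Level using (0ℓ)
open import Axiom.ExcludedMiddle using (ExcludedMiddle)
open import Axiom.DoubleNegationElimination using (em⇒dne)
open import Function.Bundles using (_⇔_; mk⇔)
open import Relation.Binary.Bundles using (Poset)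
open import Data.Product using (∃; _×_; _,_)
open import Data.Sum using (_⊎_; inj₁; inj₂; [_,_]; map₂)
open import Data.Empty using (⊥-elim)
open import Data.Unit using (tt)
open import Relation.Nullary using (¬_; yes; no)

module DerivedRelations (F : Frame) where
  open Frame F using (poset; _≤_)
  open FrameOps F
  open Poset poset using (trans)

  R□+-upʳ : ∀ {u v v′} → R□+ u v → v ≤ v′ → R□+ u v′
  R□+-upʳ (x , u≤x , y , xRy , y≤v) v≤v′ = x , u≤x , y , xRy , trans y≤v v≤v′

  R◇--upʳ : ∀ {u v v′} → R◇- u v → v ≤ v′ → R◇- u v′
  R◇--upʳ (x , x≤u , y , xRy , y≤v) v≤v′ = x , x≤u , y , xRy , trans y≤v v≤v′

  R◇+-downʳ : ∀ {u v v′} → R◇+ u v → v′ ≤ v → R◇+ u v′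
  R◇+-downʳ (x , x≤u , y , xRy , v≤y) v′≤v = x , x≤u , y , xRy , trans v′≤v v≤y

  R□--downʳ : ∀ {u v v′} → R□- u v → v′ ≤ v → R□- u v′
  R□--downʳ (x , u≤x , y , xRy , v≤y) v′≤v = x , u≤x , y , xRy , trans v′≤v v≤y

  ↑_ : W → Upset
  ↑ v = record { set = v ≤_ ; up = λ _ _ x≤y v≤x → trans v≤x x≤y }

  ∁↓_ : W → Upset
  ∁↓ v = record { set = λ w → ¬ w ≤ v ; up = λ _ _ x≤y x≰v y≤v → x≰v (trans x≤y y≤v) }

  R□+[_] : W → Upset
  R□+[ u ] = record { set = R□+ u ; up = λ _ _ x≤y r → R□+-upʳ r x≤y }

  R◇-[_] : W → Upset
  R◇-[ u ] = record { set = R◇- u ; up = λ _ _ x≤y r → R◇--upʳ r x≤y }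

  ∁R□-[_] : W → Upset
  ∁R□-[ u ] = record { set = λ w → ¬ R□- u w ; up = λ _ _ x≤y ¬r r → ¬r (R□--downʳ r x≤y) }

  ∁R◇+[_] : W → Upset
  ∁R◇+[ u ] = record { set = λ w → ¬ R◇+ u w ; up = λ _ _ x≤y ¬r r → ¬r (R◇+-downʳ r x≤y) }

module Correspondence (em : ExcludedMiddle 0ℓ) (F : Frame) where
  open Frame F using (poset; _≤_)
  open FrameOps F
  open Poset poset using (refl)
  open DerivedRelations F

  dne : {P : Set} → ¬ ¬ P → P
  dne = em⇒dne em

  □+-or-counterexample : ∀ (a : Pred) u → □+ a u ⊎ ∃ λ v → R□+ u v × ¬ a v
  □+-or-counterexample a u with em {∃ λ v → R□+ u v × ¬ a v}
  ... | yes counterexample = inj₂ counterexample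
  ... | no none = inj₁ λ v r → dne λ ¬av → none (v , r , ¬av)

  □--or-witness : ∀ (a : Pred) u → □- a u ⊎ ∃ λ v → R□- u v × a v
  □--or-witness a u with em {∃ λ v → R□- u v × a v}
  ... | yes witness = inj₂ witness
  ... | no none = inj₁ λ v r av → none (v , r , av)

  ⇒-counterexample : ∀ {a b : Pred} {u} → ¬ (a ⇒ b) u → ∃ λ v → u ≤ v × a v × ¬ b v
  ⇒-counterexample ¬a⇒b =
    dne λ none → ¬a⇒b λ v u≤v av → dne λ ¬bv → none (v , u≤v , av , ¬bv)

  condition⇒validates : ∀ e → condition e → validates e
  condition⇒validates DpBp c _ b u (□a , v , bv , r) with c u v r
  ... | w , (r◇ , r□) , v≤w = w , (□a w r□ , up b v w v≤w bv) , r◇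
  condition⇒validates DmBm c _ b u (□-a , v , ¬bv , r) with c u v r
  ... | w , (r◇ , r□) , w≤v = w , (λ { (inj₁ aw) → □-a w r□ aw
                                     ; (inj₂ bw) → ¬bv (up b w v w≤v bw) }) , r◇
  condition⇒validates BpDp c a _ u □a∨b with □+-or-counterexample (set a) u
  ... | inj₁ □a = inj₁ □a
  ... | inj₂ (v , r , ¬av) with c u v r
  ... | w , (r□ , r◇) , w≤v with □a∨b w r□
  ... | inj₁ aw = ⊥-elim (¬av (up a w v w≤v aw))
  ... | inj₂ bw = inj₂ (w , bw , r◇)
  condition⇒validates BmDm c a b u □-a∧b = map₂ extend (□--or-witness (set a) u)
    where
    extend : (∃ λ v → R□- u v × set a v) → ◇- (set b) u
    extend (v , r , av) with c u v r
    ... | w , (r□ , r◇) , v≤w = w , (λ bw → □-a∧b w r□ (up a v w v≤w av , bw)) , r◇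
  condition⇒validates DpBm c _ _ u (□-a , v , av , r) = □-a v (c u v r) av
  condition⇒validates DmBp c _ _ u (□a , v , ¬av , r) = ¬av (□a v (c u v r))
  condition⇒validates BpDm c a _ u _ =
    map₂ (λ (v , r , ¬av) → v , ¬av , c u v r) (□+-or-counterexample (set a) u)
  condition⇒validates BmDp c a _ u _ =
    map₂ (λ (v , r , av) → v , av , c u v r) (□--or-witness (set a) u)
  condition⇒validates bDpBp c _ _ u ◇a⇒□b v r v′ v≤v′ av′ with c u v′ (R□+-upʳ r v≤v′)
  ... | u′ , u≤u′ , (r□ , r◇) = ◇a⇒□b u′ u≤u′ (v′ , av′ , r◇) v′ r□
  condition⇒validates bDmBm c _ _ u (v , ¬a⇒b , r) with ⇒-counterexample ¬a⇒b
  ... | v′ , v≤v′ , av′ , ¬bv′ with c u v′ (R◇--upʳ r v≤v′)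
  ... | u′ , u′≤u , (r◇ , r□) = u′ , u′≤u , (v′ , ¬bv′ , r◇) , λ □-a → □-a v′ r□ av′
  condition⇒validates bBpDp c _ _ u (v , (v′ , v′≤v , bv′ , ¬av′) , r)
    with c u v′ (R◇+-downʳ r v′≤v)
  ... | u′ , u′≤u , (r◇ , r□) = u′ , u′≤u , (v′ , bv′ , r◇) , λ □a → ¬av′ (□a v′ r□)
  condition⇒validates bBmDm c _ _ u ◇-a⇒□-b v r (v′ , v′≤v , bv′ , ¬av′)
    with c u v′ (R□--downʳ r v′≤v)
  ... | u′ , u≤u′ , (r□ , r◇) = ◇-a⇒□-b u′ u≤u′ (v′ , ¬av′ , r◇) v′ r□ bv′
  condition⇒validates bDpBm c _ _ u □-a v r v′ v≤v′ av′ = □-a v′ (c u v′ (R□+-upʳ r v≤v′)) av′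
  condition⇒validates bDmBp c _ _ u (v , ¬¬a , r) with ⇒-counterexample ¬¬a
  ... | v′ , v≤v′ , av′ , _ = v′ , av′ , c u v′ (R◇--upʳ r v≤v′)
  condition⇒validates bBpDm c _ _ u (v , (v′ , v′≤v , _ , ¬av′) , r) =
    v′ , ¬av′ , c u v′ (R◇+-downʳ r v′≤v)
  condition⇒validates bBmDp c _ _ u □a v r (v′ , v′≤v , _ , ¬av′) =
    ¬av′ (□a v′ (c u v′ (R□--downʳ r v′≤v)))

  validates⇒condition : ∀ e → validates e → condition e
  validates⇒condition DpBp V u v r with V R□+[ u ] (↑ v) u ((λ _ r□ → r□) , v , refl , r)
  ... | w , (r□ , v≤w) , r◇ = w , (r◇ , r□) , v≤w
  validates⇒condition DmBm V u v r
    with V ∁R□-[ u ] (∁↓ v) u ((λ _ r□ ¬r□ → ¬r□ r□) , v , (λ v≰v → v≰v refl) , r)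
  ... | w , ¬either , r◇ =
    w , (r◇ , dne λ ¬r□ → ¬either (inj₁ ¬r□)) , dne λ w≰v → ¬either (inj₂ w≰v)
  validates⇒condition BpDp V u v r = dne λ ¬goal →
    [ (λ □v≰ → □v≰ v r refl) , (λ (_ , ¬r◇ , r◇) → ¬r◇ r◇) ]
      (V (∁↓ v) ∁R◇+[ u ] u λ w r□ → dne λ neither →
        ¬goal (w , (r□ , dne λ ¬r◇ → neither (inj₂ ¬r◇)) , dne λ w≰v → neither (inj₁ w≰v)))
  validates⇒condition BmDm V u v r = dne λ ¬goal →
    [ (λ □-v≤ → □-v≤ v r refl) , (λ (_ , ¬r◇ , r◇) → ¬r◇ r◇) ]
      (V (↑ v) R◇-[ u ] u λ w r□ (v≤w , r◇) → ¬goal (w , (r□ , r◇) , v≤w))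
  validates⇒condition DpBm V u v r = dne λ ¬r□ →
    V (↑ v) (↑ v) u ((λ w r□ v≤w → ¬r□ (R□--downʳ r□ v≤w)) , v , refl , r)
  validates⇒condition DmBp V u v r = dne λ ¬r□ →
    V R□+[ u ] R□+[ u ] u ((λ _ r□ → r□) , v , ¬r□ , r)
  validates⇒condition BpDm V u v r =
    [ (λ □v≰ → ⊥-elim (□v≰ v r refl)) , (λ (_ , ¬w≰v , r◇) → R◇--upʳ r◇ (dne ¬w≰v)) ]
      (V (∁↓ v) (∁↓ v) u tt)
  validates⇒condition BmDp V u v r =
    [ (λ □-v≤ → ⊥-elim (□-v≤ v r refl)) , (λ (_ , v≤w , r◇) → R◇+-downʳ r◇ v≤w) ]
      (V (↑ v) (↑ v) u tt)
  validates⇒condition bDpBp V u v r = dne λ ¬goal →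
    V (↑ v) (∁↓ v) u
      (λ u′ u≤u′ (w , v≤w , r◇) w′ r□ w′≤v →
        ¬goal (u′ , u≤u′ , R□+-upʳ r□ w′≤v , R◇+-downʳ r◇ v≤w))
      v r v refl refl refl
  validates⇒condition bDmBm V u v r
    with V (↑ v) (∁↓ v) u (v , (λ v≤⇒v≰ → v≤⇒v≰ v refl refl refl) , r)
  ... | u′ , u′≤u , (_ , ¬w≰v , r◇) , ¬□-v≤ =
    u′ , u′≤u , R◇--upʳ r◇ (dne ¬w≰v) ,
    dne λ ¬r□ → ¬□-v≤ λ w′ r□ v≤w′ → ¬r□ (R□--downʳ r□ v≤w′)
  validates⇒condition bBpDp V u v r
    with V (∁↓ v) (↑ v) u (v , (v , refl , refl , λ v≰v → v≰v refl) , r)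
  ... | u′ , u′≤u , (_ , v≤w , r◇) , ¬□v≰ =
    u′ , u′≤u , R◇+-downʳ r◇ v≤w ,
    dne λ ¬r□ → ¬□v≰ λ w′ r□ w′≤v → ¬r□ (R□+-upʳ r□ w′≤v)
  validates⇒condition bBmDm V u v r = dne λ ¬goal →
    V (∁↓ v) (↑ v) u
      (λ u′ u≤u′ (w , ¬w≰v , r◇) w′ r□ v≤w′ →
        ¬goal (u′ , u≤u′ , R□--downʳ r□ v≤w′ , R◇--upʳ r◇ (dne ¬w≰v)))
      v r (v , refl , refl , λ v≰v → v≰v refl)
  validates⇒condition bDpBm V u v r = dne λ ¬r□ →
    V (↑ v) (↑ v) u (λ w r□ v≤w → ¬r□ (R□--downʳ r□ v≤w)) v r v refl refl
  validates⇒condition bDmBp V u v r with V (↑ v) (↑ v) u (v , (λ v≤⇒⊥ → v≤⇒⊥ v refl refl) , r)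
  ... | _ , v≤w , r◇ = R◇+-downʳ r◇ v≤w
  validates⇒condition bBpDm V u v r
    with V (∁↓ v) (∁↓ v) u (v , (v , refl , tt , λ v≰v → v≰v refl) , r)
  ... | _ , ¬w≰v , r◇ = R◇--upʳ r◇ (dne ¬w≰v)
  validates⇒condition bBmDp V u v r = dne λ ¬r□ →
    V R□+[ u ] R□+[ u ] u (λ _ r□ → r□) v r (v , refl , tt , ¬r□)

mainTheorem10 : ExcludedMiddle 0ℓ → (e : Label) (F : Frame) →
    FrameCondition e F ⇔ ComplexAlgebraSatisfies e F
mainTheorem10 em e F = mk⇔ (condition⇒validates e) (validates⇒condition e)
  where open Correspondence em F
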